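{- Let $\mathbf A$ be a Stonean residuated lattice. The assignment $F\mapsto\mathbf S_F$, where $\mathbf S_F$ is the subalgebra of $K(\mathbf A)$ with universe $\{(a,b)\in A\times A:\neg a\to\neg\neg b\in F\}$, is a bijection from the set of lattice filters of $\mathbf A$ containing all dense elements onto the set of all admissible subalgebras of $K(\mathbf A)$.
   Context: A bounded commutative residuated lattice is $(A,\vee,\wedge,\cdot,\to,0,1)$ with $(A,\vee,\wedge)$ a lattice, $(A,\cdot,1)$ a commutative monoid, $ab\le c$ iff $a\le b\to c$, $1$ greatest, $0$ least; $\neg x:=x\to0$. It is Stonean if it satisfies $\neg x\vee\neg\neg x=1$. An element $x$ is dense if $\neg x=0$. $K(\mathbf A)$ is the algebra on $A\times A$ with $(a,b)\vee(c,d)=(a\vee c,b\wedge d)$, $(a,b)\wedge(c,d)=(a\wedge c,b\vee d)$, $(a,b)(c,d)=(ac,(a\to d)\wedge(c\to b))$, $(a,b)\to(c,d)=((a\to c)\wedge(d\to b),ad)$, unit $(1,1)$, constant $0$ as $(0,1)$. A subalgebra $\mathbf S$ of $K(\mathbf A)$ is admissible if its elements below $(1,1)$ are exactly all $(a,1)$, $a\in A$. -}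

module Defs where

open import Level using (Level; suc; _⊔_)
open import Data.Product using (Σ; ∃; _×_; _,_; proj₁; proj₂)
open import Relation.Binary.PropositionalEquality using (_≡_)
open import Relation.Unary using (Pred; _⊆_; _∈_)
open import Algebra.Lattice.Structures using (IsLattice)
open import Algebra.Structures using (IsCommutativeMonoid)

record ResiduatedLattice (c : Level) : Set (suc c) where
  infixr 5 _⇒_
  infixl 7 _·_
  infixr 6 _∨_
  infixr 7 _∧_
  infix 4 _≤_
  field
    Carrier : Set c
    _∨_ _∧_ _·_ _⇒_ : Carrier → Carrier → Carrier
    0# 1# : Carrier
    isLattice : IsLattice _≡_ _∨_ _∧_
    isCommutativeMonoid : IsCommutativeMonoid _≡_ _·_ 1#

  _≤_ : Carrier → Carrier → Set c
  x ≤ y = x ∧ y ≡ x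

  field
    residuation-⇒ : ∀ a b d → a · b ≤ d → a ≤ (b ⇒ d)
    residuation-⇐ : ∀ a b d → a ≤ (b ⇒ d) → a · b ≤ d
    top : ∀ x → x ≤ 1#
    bottom : ∀ x → 0# ≤ x

  ¬_ : Carrier → Carrier
  ¬ x = x ⇒ 0#

  Dense : Carrier → Set c
  Dense x = ¬ x ≡ 0#

IsStonean : ∀ {c} → ResiduatedLattice c → Set c
IsStonean A = ∀ x → (¬ x) ∨ (¬ (¬ x)) ≡ 1#
  where open ResiduatedLattice A

_≐_ : ∀ {a ℓ} {X : Set a} → Pred X ℓ → Pred X ℓ → Set (a ⊔ ℓ)
P ≐ Q = (P ⊆ Q) × (Q ⊆ P)

module _ {c : Level} (A : ResiduatedLattice c) where
  open ResiduatedLattice A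

  K∨ K∧ K· K⇒ : Carrier × Carrier → Carrier × Carrier → Carrier × Carrier
  K∨ (a , b) (d , e) = (a ∨ d , b ∧ e)
  K∧ (a , b) (d , e) = (a ∧ d , b ∨ e)
  K· (a , b) (d , e) = (a · d , (a ⇒ e) ∧ (d ⇒ b))
  K⇒ (a , b) (d , e) = ((a ⇒ d) ∧ (e ⇒ b) , a · e)

  K1 K0 : Carrier × Carrier
  K1 = (1# , 1#)
  K0 = (0# , 1#)

  _K≤_ : Carrier × Carrier → Carrier × Carrier → Set c
  p K≤ q = K∧ p q ≡ p

  record IsLatticeFilter (F : Pred Carrier c) : Set c where
    field
      nonempty : ∃ λ x → x ∈ F
      upward : ∀ {x y} → x ∈ F → x ≤ y → y ∈ F
      meet : ∀ {x y} → x ∈ F → y ∈ F → (x ∧ y) ∈ F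

  record IsDenseFilter (F : Pred Carrier c) : Set c where
    field
      isLatticeFilter : IsLatticeFilter F
      dense⊆ : ∀ x → Dense x → x ∈ F

  record IsSubalgebra (S : Pred (Carrier × Carrier) c) : Set c where
    field
      ∨-closed : ∀ {p q} → p ∈ S → q ∈ S → K∨ p q ∈ S
      ∧-closed : ∀ {p q} → p ∈ S → q ∈ S → K∧ p q ∈ S
      ·-closed : ∀ {p q} → p ∈ S → q ∈ S → K· p q ∈ S
      ⇒-closed : ∀ {p q} → p ∈ S → q ∈ S → K⇒ p q ∈ S
      1-closed : K1 ∈ S
      0-closed : K0 ∈ S

  record IsAdmissible (S : Pred (Carrier × Carrier) c) : Set c where
    field
      isSubalgebra : IsSubalgebra S
      contains-a1 : ∀ a → (a , 1#) ∈ S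
      below-1 : ∀ {p} → p ∈ S → p K≤ K1 → Σ Carrier λ a → p ≡ (a , 1#)

  S[_] : Pred Carrier c → Pred (Carrier × Carrier) c
  S[ F ] (a , b) = ((¬ a) ⇒ (¬ (¬ b))) ∈ F

-- Write gap (a , b) = ¬ a · ¬ b. By currying, (a , b) ∈ S[ F ] iff ¬ gap (a , b) ∈ F, and the
-- elements w with ¬ w ∈ F form an ideal. In a Stonean lattice ¬ (x · y) ≤ ¬ x ∨ ¬ y, which bounds
-- the gap of each K(A)-operation by the join of the gaps of its arguments, so S[ F ] is a subalgebra.
-- F is recovered as {x : (x , 0) ∈ S[ F ]} once it contains the dense elements, because x ∨ ¬ x is
-- dense and (x ∨ ¬ x) ∧ ¬ ¬ x ≤ x. Conversely, an admissible S yields the dense filter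
-- {x : (x , 0) ∈ S}, and each (a , b) ∈ S[ F ] is rebuilt inside S as (¬ b ∧ y , b) ∨ (a , 1)
-- with y = (a ∨ ¬ a) ∧ (¬ a ⇒ ¬ ¬ b).

module Submission where

open import Defs
open import Level using (Level)
open import Data.Product using (Σ; _×_; _,_; proj₂)
open import Relation.Unary using (Pred; _∈_; _⊆_)
open import Relation.Binary.PropositionalEquality
  using (_≡_; refl; sym; trans; cong; cong₂; subst; isEquivalence)
open import Relation.Binary.Bundles using (Poset)
open import Relation.Binary.Structures using (IsPartialOrder)
import Relation.Binary.Lattice as OrderTheoretic
import Relation.Binary.Reasoning.PartialOrder as PartialOrderReasoning
open import Algebra.Bundles using (CommutativeMonoid)
open import Algebra.Lattice.Bundles using (Lattice)
open import Algebra.Lattice.Structures using (IsLattice)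
open import Algebra.Lattice.Properties.Lattice using (∨-∧-orderTheoreticLattice)
import Algebra.Properties.CommutativeSemigroup as CommutativeSemigroupProperties

module OrderProperties {c : Level} (A : ResiduatedLattice c) where
  open ResiduatedLattice A
  open IsLattice isLattice using (∨-comm; ∧-comm)

  private
    lattice : Lattice c c
    lattice = record
      { Carrier = Carrier ; _≈_ = _≡_ ; _∨_ = _∨_ ; _∧_ = _∧_ ; isLattice = isLattice }

    -- ordered by  x ≡ x ∧ y,  the symmetric form of  _≤_
    module O = OrderTheoretic.Lattice (∨-∧-orderTheoreticLattice lattice)

  ≤-isPartialOrder : IsPartialOrder _≡_ _≤_
  ≤-isPartialOrder = record
    { isPreorder = record
      { isEquivalence = isEquivalence
      ; reflexive = λ { refl → sym O.refl }
      ; trans = λ p q → sym (O.trans (sym p) (sym q))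
      }
    ; antisym = λ p q → O.antisym (sym p) (sym q)
    }

  ≤-poset : Poset c c c
  ≤-poset = record { isPartialOrder = ≤-isPartialOrder }

  open IsPartialOrder ≤-isPartialOrder public using ()
    renaming (refl to ≤-refl; reflexive to ≤-reflexive; trans to ≤-trans; antisym to ≤-antisym)

  module ≤-Reasoning = PartialOrderReasoning ≤-poset

  x∧y≤x : ∀ x y → x ∧ y ≤ x
  x∧y≤x x y = sym (O.x∧y≤x x y)

  x∧y≤y : ∀ x y → x ∧ y ≤ y
  x∧y≤y x y = sym (O.x∧y≤y x y)

  ∧-greatest : ∀ {x y z} → z ≤ x → z ≤ y → z ≤ x ∧ y
  ∧-greatest p q = sym (O.∧-greatest (sym p) (sym q))

  x≤x∨y : ∀ x y → x ≤ x ∨ y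
  x≤x∨y x y = sym (O.x≤x∨y x y)

  y≤x∨y : ∀ x y → y ≤ x ∨ y
  y≤x∨y x y = sym (O.y≤x∨y x y)

  ∨-least : ∀ {x y z} → x ≤ z → y ≤ z → x ∨ y ≤ z
  ∨-least p q = sym (O.∨-least (sym p) (sym q))

  x≤y⇒x≤y∨z : ∀ {x y} z → x ≤ y → x ≤ y ∨ z
  x≤y⇒x≤y∨z {y = y} z p = ≤-trans p (x≤x∨y y z)

  x≤z⇒x≤y∨z : ∀ {x z} y → x ≤ z → x ≤ y ∨ z
  x≤z⇒x≤y∨z {z = z} y p = ≤-trans p (y≤x∨y y z)

  ∨-mono-≤ : ∀ {x y u v} → x ≤ y → u ≤ v → x ∨ u ≤ y ∨ v
  ∨-mono-≤ {y = y} {v = v} p q = ∨-least (x≤y⇒x≤y∨z v p) (x≤z⇒x≤y∨z y q)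

  x≤0⇒x≤y : ∀ {x} y → x ≤ 0# → x ≤ y
  x≤0⇒x≤y y p = ≤-trans p (bottom y)

  x≤y⇒x∨y≡y : ∀ {x y} → x ≤ y → x ∨ y ≡ y
  x≤y⇒x∨y≡y {x} {y} p = ≤-antisym (∨-least p ≤-refl) (y≤x∨y x y)

  x≤0⇒x≡0 : ∀ {x} → x ≤ 0# → x ≡ 0#
  x≤0⇒x≡0 p = ≤-antisym p (bottom _)

  1≤x⇒x≡1 : ∀ {x} → 1# ≤ x → x ≡ 1#
  1≤x⇒x≡1 p = ≤-antisym (top _) p

  1∧x≡x : ∀ x → 1# ∧ x ≡ x
  1∧x≡x x = trans (∧-comm 1# x) (top x)

  x∨0≡x : ∀ x → x ∨ 0# ≡ x
  x∨0≡x x = trans (∨-comm x 0#) (x≤y⇒x∨y≡y (bottom x))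

module ResiduationProperties {c : Level} (A : ResiduatedLattice c) where
  open ResiduatedLattice A
  open OrderProperties A
  open ≤-Reasoning

  private
    monoid : CommutativeMonoid c c
    monoid = record
      { Carrier = Carrier ; _≈_ = _≡_ ; _∙_ = _·_ ; ε = 1#
      ; isCommutativeMonoid = isCommutativeMonoid }

  open CommutativeMonoid monoid public using ()
    renaming (assoc to ·-assoc; comm to ·-comm; identityʳ to ·-identityʳ)
  open CommutativeSemigroupProperties (CommutativeMonoid.commutativeSemigroup monoid)
    using (xy∙z≈xz∙y; xy∙z≈x∙zy)

  transpose-⇒ : ∀ {x y z} → x · y ≤ z → x ≤ y ⇒ z
  transpose-⇒ = residuation-⇒ _ _ _

  transpose-· : ∀ {x y z} → x ≤ y ⇒ z → x · y ≤ z
  transpose-· = residuation-⇐ _ _ _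

  ⇒-eval : ∀ {x y} → (x ⇒ y) · x ≤ y
  ⇒-eval = transpose-· ≤-refl

  ·-monoˡ-≤ : ∀ {x y} z → x ≤ y → x · z ≤ y · z
  ·-monoˡ-≤ z p = transpose-· (≤-trans p (transpose-⇒ ≤-refl))

  ·-monoʳ-≤ : ∀ {x y} z → x ≤ y → z · x ≤ z · y
  ·-monoʳ-≤ {x} {y} z p = begin
    z · x  ≡⟨ ·-comm z x ⟩
    x · z  ≤⟨ ·-monoˡ-≤ z p ⟩
    y · z  ≡⟨ ·-comm y z ⟩
    z · y  ∎

  ·-mono-≤ : ∀ {x y u v} → x ≤ y → u ≤ v → x · u ≤ y · v
  ·-mono-≤ {y = y} {u} p q = ≤-trans (·-monoˡ-≤ u p) (·-monoʳ-≤ y q)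

  x·y≤y : ∀ x y → x · y ≤ y
  x·y≤y x y = ≤-trans (·-monoˡ-≤ y (top x)) (≤-reflexive (trans (·-comm 1# y) (·-identityʳ y)))

  x·y≤x : ∀ x y → x · y ≤ x
  x·y≤x x y = ≤-trans (≤-reflexive (·-comm x y)) (x·y≤y y x)

  ∨·-least : ∀ {x y z t} → x · z ≤ t → y · z ≤ t → (x ∨ y) · z ≤ t
  ∨·-least p q = transpose-· (∨-least (transpose-⇒ p) (transpose-⇒ q))

  ·∨-least : ∀ {x y z t} → x · y ≤ t → x · z ≤ t → x · (y ∨ z) ≤ t
  ·∨-least {x} {y} {z} p q =
    ≤-trans (≤-reflexive (·-comm x (y ∨ z)))
            (∨·-least (≤-trans (≤-reflexive (·-comm y x)) p)
                      (≤-trans (≤-reflexive (·-comm z x)) q))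

  ·-distribˡ-∨-≤ : ∀ x y z → x · (y ∨ z) ≤ x · y ∨ x · z
  ·-distribˡ-∨-≤ x y z = ·∨-least (x≤x∨y _ _) (y≤x∨y _ _)

  ⇒-monoʳ-≤ : ∀ {x y} z → x ≤ y → z ⇒ x ≤ z ⇒ y
  ⇒-monoʳ-≤ z p = transpose-⇒ (≤-trans ⇒-eval p)

  ⇒-antimonoˡ-≤ : ∀ {x y} z → x ≤ y → y ⇒ z ≤ x ⇒ z
  ⇒-antimonoˡ-≤ z p = transpose-⇒ (≤-trans (·-monoʳ-≤ _ p) ⇒-eval)

  ⇒-curry : ∀ x y z → x · y ⇒ z ≡ x ⇒ y ⇒ z
  ⇒-curry x y z = ≤-antisym
    (transpose-⇒ (transpose-⇒ (≤-trans (≤-reflexive (·-assoc _ x y)) ⇒-eval)))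
    (transpose-⇒ (≤-trans (≤-reflexive (sym (·-assoc _ x y)))
                          (≤-trans (·-monoˡ-≤ y ⇒-eval) ⇒-eval)))

  1⇒x≡x : ∀ x → 1# ⇒ x ≡ x
  1⇒x≡x x = ≤-antisym (≤-trans (≤-reflexive (sym (·-identityʳ _))) ⇒-eval)
                      (transpose-⇒ (x·y≤x x 1#))

  x⇒1≡1 : ∀ x → x ⇒ 1# ≡ 1#
  x⇒1≡1 x = 1≤x⇒x≡1 (transpose-⇒ (top _))

  ¬-antimono-≤ : ∀ {x y} → x ≤ y → ¬ y ≤ ¬ x
  ¬-antimono-≤ = ⇒-antimonoˡ-≤ 0#

  ¬x·x≤0 : ∀ x → ¬ x · x ≤ 0#
  ¬x·x≤0 x = ⇒-eval

  x·¬x≤0 : ∀ x → x · ¬ x ≤ 0#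
  x·¬x≤0 x = ≤-trans (≤-reflexive (·-comm x (¬ x))) ⇒-eval

  x≤¬¬x : ∀ x → x ≤ ¬ ¬ x
  x≤¬¬x x = transpose-⇒ (x·¬x≤0 x)

  ¬1≤0 : ¬ 1# ≤ 0#
  ¬1≤0 = ≤-reflexive (1⇒x≡x 0#)

  x≤0⇒¬x≡1 : ∀ {x} → x ≤ 0# → ¬ x ≡ 1#
  x≤0⇒¬x≡1 p = 1≤x⇒x≡1 (transpose-⇒ (≤-trans (x·y≤y 1# _) p))

  ¬0≡1 : ¬ 0# ≡ 1#
  ¬0≡1 = x≤0⇒¬x≡1 ≤-refl

  ¬x∧¬y≤¬[x∨y] : ∀ x y → ¬ x ∧ ¬ y ≤ ¬ (x ∨ y)
  ¬x∧¬y≤¬[x∨y] x y = transpose-⇒ (·∨-least (≤-trans (·-monoˡ-≤ x (x∧y≤x _ _)) ⇒-eval)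
                                   (≤-trans (·-monoˡ-≤ y (x∧y≤y _ _)) ⇒-eval))

  ¬[x⇒y]≤¬y : ∀ x y → ¬ (x ⇒ y) ≤ ¬ y
  ¬[x⇒y]≤¬y x y = ¬-antimono-≤ (transpose-⇒ (x·y≤x y x))

  ¬[x⇒y]≤¬¬x : ∀ x y → ¬ (x ⇒ y) ≤ ¬ ¬ x
  ¬[x⇒y]≤¬¬x x y = ¬-antimono-≤ (transpose-⇒ (≤-trans (¬x·x≤0 x) (bottom y)))

  ¬x·¬[x⇒y]≤0 : ∀ x y → ¬ x · ¬ (x ⇒ y) ≤ 0#
  ¬x·¬[x⇒y]≤0 x y = ≤-trans (·-monoʳ-≤ (¬ x) (¬[x⇒y]≤¬¬x x y)) (x·¬x≤0 (¬ x))

  ¬[x⇒y]·¬x≤0 : ∀ x y → ¬ (x ⇒ y) · ¬ x ≤ 0#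
  ¬[x⇒y]·¬x≤0 x y = ≤-trans (≤-reflexive (·-comm _ (¬ x))) (¬x·¬[x⇒y]≤0 x y)

  ¬[x·y]·¬¬x≤¬y : ∀ x y → ¬ (x · y) · ¬ ¬ x ≤ ¬ y
  ¬[x·y]·¬¬x≤¬y x y = transpose-⇒ (begin
    (¬ (x · y) · ¬ ¬ x) · y  ≡⟨ xy∙z≈xz∙y _ _ y ⟩
    (¬ (x · y) · y) · ¬ ¬ x  ≤⟨ ·-monoˡ-≤ _ ¬[x·y]·y≤¬x ⟩
    ¬ x · ¬ ¬ x              ≤⟨ x·¬x≤0 (¬ x) ⟩
    0#                       ∎)
    where
    ¬[x·y]·y≤¬x : ¬ (x · y) · y ≤ ¬ x
    ¬[x·y]·y≤¬x = transpose-⇒ (begin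
      (¬ (x · y) · y) · x  ≡⟨ xy∙z≈x∙zy _ y x ⟩
      ¬ (x · y) · (x · y)  ≤⟨ ¬x·x≤0 (x · y) ⟩
      0#                   ∎)

module StoneanProperties {c : Level} (A : ResiduatedLattice c) (stonean : IsStonean A) where
  open ResiduatedLattice A
  open OrderProperties A
  open ResiduationProperties A
  open ≤-Reasoning

  ≤-stonean-split : ∀ x y → x ≤ x · ¬ y ∨ x · ¬ ¬ y
  ≤-stonean-split x y = begin
    x                    ≡⟨ sym (·-identityʳ x) ⟩
    x · 1#               ≡⟨ cong (x ·_) (sym (stonean y)) ⟩
    x · (¬ y ∨ ¬ ¬ y)    ≤⟨ ·-distribˡ-∨-≤ x (¬ y) (¬ ¬ y) ⟩
    x · ¬ y ∨ x · ¬ ¬ y  ∎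

  ¬[x·y]≤¬x∨¬y : ∀ x y → ¬ (x · y) ≤ ¬ x ∨ ¬ y
  ¬[x·y]≤¬x∨¬y x y = begin
    ¬ (x · y)                                ≤⟨ ≤-stonean-split (¬ (x · y)) x ⟩
    ¬ (x · y) · ¬ x ∨ ¬ (x · y) · ¬ ¬ x      ≤⟨ ∨-mono-≤ (x·y≤y _ (¬ x)) (¬[x·y]·¬¬x≤¬y x y) ⟩
    ¬ x ∨ ¬ y                                ∎

  ¬[x∧y]≤¬x∨¬y : ∀ x y → ¬ (x ∧ y) ≤ ¬ x ∨ ¬ y
  ¬[x∧y]≤¬x∨¬y x y = ≤-trans (¬-antimono-≤ (∧-greatest (x·y≤x x y) (x·y≤y x y))) (¬[x·y]≤¬x∨¬y x y)

  ¬x∧¬¬x≤0 : ∀ x → ¬ x ∧ ¬ ¬ x ≤ 0#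
  ¬x∧¬¬x≤0 x = ≤-trans (≤-stonean-split (¬ x ∧ ¬ ¬ x) x) (∨-least
    (≤-trans (·-monoˡ-≤ (¬ x) (x∧y≤y _ _)) (¬x·x≤0 (¬ x)))
    (≤-trans (·-monoˡ-≤ (¬ ¬ x) (x∧y≤x _ _)) (x·¬x≤0 (¬ x))))

  x∨¬x-dense : ∀ x → Dense (x ∨ ¬ x)
  x∨¬x-dense x = x≤0⇒x≡0 (≤-trans
    (∧-greatest (¬-antimono-≤ (x≤x∨y x (¬ x))) (¬-antimono-≤ (y≤x∨y x (¬ x))))
    (¬x∧¬¬x≤0 x))

  [x∨¬x]∧¬¬x≤x : ∀ x → (x ∨ ¬ x) ∧ ¬ ¬ x ≤ x
  [x∨¬x]∧¬¬x≤x x = ≤-trans (≤-stonean-split ((x ∨ ¬ x) ∧ ¬ ¬ x) x) (∨-least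
    (x≤0⇒x≤y x (≤-trans (·-monoˡ-≤ (¬ x) (x∧y≤y _ _)) (¬x·x≤0 (¬ x))))
    (≤-trans (·-monoˡ-≤ (¬ ¬ x) (x∧y≤x _ _))
             (∨·-least (x·y≤x x _) (x≤0⇒x≤y x (x·¬x≤0 (¬ x))))))

  ¬y∧[x⇒¬¬y]≤¬x : ∀ x y → ¬ y ∧ (x ⇒ ¬ ¬ y) ≤ ¬ x
  ¬y∧[x⇒¬¬y]≤¬x x y = transpose-⇒ (≤-trans
    (∧-greatest (≤-trans (x·y≤x _ x) (x∧y≤x _ _))
                (≤-trans (·-monoˡ-≤ x (x∧y≤y _ _)) ⇒-eval))
    (¬x∧¬¬x≤0 y))

  gap : Carrier × Carrier → Carrier
  gap (a , b) = ¬ a · ¬ b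

  gap-K∨ : ∀ p q → gap (K∨ A p q) ≤ gap p ∨ gap q
  gap-K∨ (a , b) (d , e) = begin
    ¬ (a ∨ d) · ¬ (b ∧ e)    ≤⟨ ·-monoʳ-≤ _ (¬[x∧y]≤¬x∨¬y b e) ⟩
    ¬ (a ∨ d) · (¬ b ∨ ¬ e)  ≤⟨ ·∨-least
      (x≤y⇒x≤y∨z _ (·-monoˡ-≤ (¬ b) (¬-antimono-≤ (x≤x∨y a d))))
      (x≤z⇒x≤y∨z _ (·-monoˡ-≤ (¬ e) (¬-antimono-≤ (y≤x∨y a d)))) ⟩
    ¬ a · ¬ b ∨ ¬ d · ¬ e    ∎

  gap-K∧ : ∀ p q → gap (K∧ A p q) ≤ gap p ∨ gap q
  gap-K∧ (a , b) (d , e) = begin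
    ¬ (a ∧ d) · ¬ (b ∨ e)    ≤⟨ ·-monoˡ-≤ _ (¬[x∧y]≤¬x∨¬y a d) ⟩
    (¬ a ∨ ¬ d) · ¬ (b ∨ e)  ≤⟨ ∨·-least
      (x≤y⇒x≤y∨z _ (·-monoʳ-≤ (¬ a) (¬-antimono-≤ (x≤x∨y b e))))
      (x≤z⇒x≤y∨z _ (·-monoʳ-≤ (¬ d) (¬-antimono-≤ (y≤x∨y b e)))) ⟩
    ¬ a · ¬ b ∨ ¬ d · ¬ e    ∎

  gap-K· : ∀ p q → gap (K· A p q) ≤ gap p ∨ gap q
  gap-K· (a , b) (d , e) = begin
    ¬ (a · d) · ¬ ((a ⇒ e) ∧ (d ⇒ b))        ≤⟨ ·-mono-≤ (¬[x·y]≤¬x∨¬y a d) (¬[x∧y]≤¬x∨¬y _ _) ⟩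
    (¬ a ∨ ¬ d) · (¬ (a ⇒ e) ∨ ¬ (d ⇒ b))    ≤⟨ ∨·-least
      (·∨-least (x≤0⇒x≤y _ (¬x·¬[x⇒y]≤0 a e))
                (x≤y⇒x≤y∨z _ (·-monoʳ-≤ (¬ a) (¬[x⇒y]≤¬y d b))))
      (·∨-least (x≤z⇒x≤y∨z _ (·-monoʳ-≤ (¬ d) (¬[x⇒y]≤¬y a e)))
                (x≤0⇒x≤y _ (¬x·¬[x⇒y]≤0 d b))) ⟩
    ¬ a · ¬ b ∨ ¬ d · ¬ e                    ∎

  gap-K⇒ : ∀ p q → gap (K⇒ A p q) ≤ gap p ∨ gap q
  gap-K⇒ (a , b) (d , e) = begin
    ¬ ((a ⇒ d) ∧ (e ⇒ b)) · ¬ (a · e)        ≤⟨ ·-mono-≤ (¬[x∧y]≤¬x∨¬y _ _) (¬[x·y]≤¬x∨¬y a e) ⟩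
    (¬ (a ⇒ d) ∨ ¬ (e ⇒ b)) · (¬ a ∨ ¬ e)    ≤⟨ ∨·-least
      (·∨-least (x≤0⇒x≤y _ (¬[x⇒y]·¬x≤0 a d))
                (x≤z⇒x≤y∨z _ (·-monoˡ-≤ (¬ e) (¬[x⇒y]≤¬y a d))))
      (·∨-least (x≤y⇒x≤y∨z _ (≤-trans (·-monoˡ-≤ (¬ a) (¬[x⇒y]≤¬y e b))
                                       (≤-reflexive (·-comm (¬ b) (¬ a)))))
                (x≤0⇒x≤y _ (¬[x⇒y]·¬x≤0 e b))) ⟩
    ¬ a · ¬ b ∨ ¬ d · ¬ e                    ∎

  gap[a,1]≤0 : ∀ a → gap (a , 1#) ≤ 0#
  gap[a,1]≤0 a = ≤-trans (x·y≤y (¬ a) (¬ 1#)) ¬1≤0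

  gap[a,0]≡¬a : ∀ a → gap (a , 0#) ≡ ¬ a
  gap[a,0]≡¬a a = trans (cong (¬ a ·_) ¬0≡1) (·-identityʳ (¬ a))

module LatticeFilterProperties {c : Level} (A : ResiduatedLattice c)
                               {F : Pred (ResiduatedLattice.Carrier A) c}
                               (filter : IsLatticeFilter A F) where
  open ResiduatedLattice A
  open OrderProperties A
  open ResiduationProperties A
  open IsLatticeFilter filter

  1∈F : 1# ∈ F
  1∈F = upward (proj₂ nonempty) (top _)

  x≤0⇒¬x∈F : ∀ {x} → x ≤ 0# → ¬ x ∈ F
  x≤0⇒¬x∈F p = subst F (sym (x≤0⇒¬x≡1 p)) 1∈F

  ¬∈F-antimono : ∀ {x y} → x ≤ y → ¬ y ∈ F → ¬ x ∈ F
  ¬∈F-antimono p q = upward q (¬-antimono-≤ p)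

  ¬∈F-∨ : ∀ {x y} → ¬ x ∈ F → ¬ y ∈ F → ¬ (x ∨ y) ∈ F
  ¬∈F-∨ p q = upward (meet p q) (¬x∧¬y≤¬[x∨y] _ _)

module FilterSubalgebra {c : Level} (A : ResiduatedLattice c) (stonean : IsStonean A)
                        {F : Pred (ResiduatedLattice.Carrier A) c}
                        (filter : IsLatticeFilter A F) where
  open ResiduatedLattice A
  open OrderProperties A
  open ResiduationProperties A
  open StoneanProperties A stonean
  open LatticeFilterProperties A filter
  open IsLatticeFilter filter

  ∈S[]⇒¬gap∈F : ∀ {p} → p ∈ S[_] A F → ¬ gap p ∈ F
  ∈S[]⇒¬gap∈F {a , b} = subst F (sym (⇒-curry (¬ a) (¬ b) 0#))

  ¬gap∈F⇒∈S[] : ∀ {p} → ¬ gap p ∈ F → p ∈ S[_] A F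
  ¬gap∈F⇒∈S[] {a , b} = subst F (⇒-curry (¬ a) (¬ b) 0#)

  gap-bounded⇒∈S[] : ∀ {p q r} → gap r ≤ gap p ∨ gap q →
                     p ∈ S[_] A F → q ∈ S[_] A F → r ∈ S[_] A F
  gap-bounded⇒∈S[] r≤p∨q p∈S q∈S =
    ¬gap∈F⇒∈S[] (¬∈F-antimono r≤p∨q (¬∈F-∨ (∈S[]⇒¬gap∈F p∈S) (∈S[]⇒¬gap∈F q∈S)))

  [a,1]∈S[] : ∀ a → (a , 1#) ∈ S[_] A F
  [a,1]∈S[] a = ¬gap∈F⇒∈S[] (x≤0⇒¬x∈F (gap[a,1]≤0 a))

  S[]-isAdmissible : IsAdmissible A (S[_] A F)
  S[]-isAdmissible = record
    { isSubalgebra = record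
      { ∨-closed = λ {p} {q} → gap-bounded⇒∈S[] (gap-K∨ p q)
      ; ∧-closed = λ {p} {q} → gap-bounded⇒∈S[] (gap-K∧ p q)
      ; ·-closed = λ {p} {q} → gap-bounded⇒∈S[] (gap-K· p q)
      ; ⇒-closed = λ {p} {q} → gap-bounded⇒∈S[] (gap-K⇒ p q)
      ; 1-closed = [a,1]∈S[] 1#
      ; 0-closed = [a,1]∈S[] 0#
      }
    ; contains-a1 = [a,1]∈S[]
    ; below-1 = λ { {a , b} _ p≤1 → a , cong (a ,_) (1≤x⇒x≡1 (1≤b p≤1)) }
    }
    where
    1≤b : ∀ {a b} → _K≤_ A (a , b) (K1 A) → 1# ≤ b
    1≤b {b = b} p≤1 = subst (1# ≤_) (cong proj₂ p≤1) (y≤x∨y b 1#)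

  ∈F⇒[x,0]∈S[] : ∀ {x} → x ∈ F → (x , 0#) ∈ S[_] A F
  ∈F⇒[x,0]∈S[] {x} x∈F =
    ¬gap∈F⇒∈S[] (subst (λ t → ¬ t ∈ F) (sym (gap[a,0]≡¬a x)) (upward x∈F (x≤¬¬x x)))

  [x,0]∈S[]⇒¬¬x∈F : ∀ {x} → (x , 0#) ∈ S[_] A F → ¬ ¬ x ∈ F
  [x,0]∈S[]⇒¬¬x∈F {x} p = subst (λ t → ¬ t ∈ F) (gap[a,0]≡¬a x) (∈S[]⇒¬gap∈F p)

module DenseFilterProperties {c : Level} (A : ResiduatedLattice c) (stonean : IsStonean A) where
  open ResiduatedLattice A
  open StoneanProperties A stonean

  ¬¬x∈F⇒x∈F : ∀ {F x} → IsDenseFilter A F → ¬ ¬ x ∈ F → x ∈ F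
  ¬¬x∈F⇒x∈F {x = x} dense ¬¬x∈F =
    upward (meet (dense⊆ _ (x∨¬x-dense x)) ¬¬x∈F) ([x∨¬x]∧¬¬x≤x x)
    where open IsDenseFilter dense
          open IsLatticeFilter isLatticeFilter

  S[]-reflects-⊆ : ∀ {F G} → IsLatticeFilter A F → IsDenseFilter A G →
                   S[_] A F ⊆ S[_] A G → F ⊆ G
  S[]-reflects-⊆ F-filter G-dense S[F]⊆S[G] x∈F =
    ¬¬x∈F⇒x∈F G-dense (FilterSubalgebra.[x,0]∈S[]⇒¬¬x∈F A stonean G-filter
      (S[F]⊆S[G] (FilterSubalgebra.∈F⇒[x,0]∈S[] A stonean F-filter x∈F)))
    where G-filter = IsDenseFilter.isLatticeFilter G-dense

module AdmissibleSubalgebra {c : Level} (A : ResiduatedLattice c)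
                            {S : Pred (ResiduatedLattice.Carrier A × ResiduatedLattice.Carrier A) c}
                            (admissible : IsAdmissible A S) where
  open ResiduatedLattice A
  open OrderProperties A
  open ResiduationProperties A
  open IsAdmissible admissible
  open IsSubalgebra isSubalgebra

  filterOf : Pred Carrier c
  filterOf x = (x , 0#) ∈ S

  -- (a , b) ⇒ (0 , 1)  is  (¬ a ∧ (1 ⇒ b) , a · 1)  in K(A)
  [¬a∧b,a]∈S : ∀ {a b} → (a , b) ∈ S → (¬ a ∧ b , a) ∈ S
  [¬a∧b,a]∈S {a} {b} p∈S =
    subst S (cong₂ _,_ (cong (¬ a ∧_) (1⇒x≡x b)) (·-identityʳ a)) (⇒-closed p∈S 0-closed)

  [0,x]∈S⇒x∈filterOf : ∀ {x} → (0# , x) ∈ S → x ∈ filterOf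
  [0,x]∈S⇒x∈filterOf {x} p∈S =
    subst (λ t → (t , 0#) ∈ S) (trans (cong (_∧ x) ¬0≡1) (1∧x≡x x)) ([¬a∧b,a]∈S p∈S)

  [¬x,x]∈S : ∀ x → (¬ x , x) ∈ S
  [¬x,x]∈S x = subst (λ t → (t , x) ∈ S) (top (¬ x)) ([¬a∧b,a]∈S (contains-a1 x))

  filterOf-isDenseFilter : IsDenseFilter A filterOf
  filterOf-isDenseFilter = record
    { isLatticeFilter = record
      { nonempty = 1# , [0,x]∈S⇒x∈filterOf 0-closed
      ; upward = λ {x} {y} x∈F x≤y →
          subst S (cong₂ _,_ (x≤y⇒x∨y≡y x≤y) (bottom 1#)) (∨-closed x∈F (contains-a1 y))
      ; meet = λ x∈F y∈F → subst (λ t → (_ , t) ∈ S) (x∨0≡x 0#) (∧-closed x∈F y∈F)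
      }
    ; dense⊆ = λ x ¬x≡0 → [0,x]∈S⇒x∈filterOf (subst (λ t → (t , x) ∈ S) ¬x≡0 ([¬x,x]∈S x))
    }

  open IsDenseFilter filterOf-isDenseFilter using (isLatticeFilter)
  open IsLatticeFilter isLatticeFilter using (upward; meet)

  S⊆S[filterOf] : ∀ {p} → p ∈ S → p ∈ S[_] A filterOf
  S⊆S[filterOf] {a , b} p∈S =
    upward ([0,x]∈S⇒x∈filterOf (subst S (cong₂ _,_ ¬a·a≡0 ¬a⇒b∧a⇒1≡¬a⇒b) [¬a,1]·p∈S))
           (⇒-monoʳ-≤ (¬ a) (x≤¬¬x b))
    where
    [¬a,1]·p∈S : K· A (¬ a , 1#) (a , b) ∈ S
    [¬a,1]·p∈S = ·-closed (contains-a1 (¬ a)) p∈S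
    ¬a·a≡0 : ¬ a · a ≡ 0#
    ¬a·a≡0 = x≤0⇒x≡0 (¬x·x≤0 a)
    ¬a⇒b∧a⇒1≡¬a⇒b : (¬ a ⇒ b) ∧ (a ⇒ 1#) ≡ ¬ a ⇒ b
    ¬a⇒b∧a⇒1≡¬a⇒b = trans (cong ((¬ a ⇒ b) ∧_) (x⇒1≡1 a)) (top _)

  S[filterOf]⊆S : IsStonean A → ∀ {p} → p ∈ S[_] A filterOf → p ∈ S
  S[filterOf]⊆S stonean {a , b} p∈S[F] =
    subst S (cong₂ _,_ (x≤y⇒x∨y≡y ¬b∧y≤a) (top b)) (∨-closed [¬b∧y,b]∈S (contains-a1 a))
    where
    open StoneanProperties A stonean
    y : Carrier
    y = (a ∨ ¬ a) ∧ (¬ a ⇒ ¬ ¬ b)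
    [¬b∧y,b]∈S : (¬ b ∧ y , b) ∈ S
    [¬b∧y,b]∈S = subst (λ t → (¬ b ∧ y , t) ∈ S) (x∨0≡x b)
      (∧-closed ([¬x,x]∈S b) (meet (dense⊆ _ (x∨¬x-dense a)) p∈S[F]))
      where open IsDenseFilter filterOf-isDenseFilter using (dense⊆)
    ¬b∧y≤a : ¬ b ∧ y ≤ a
    ¬b∧y≤a = ≤-trans
      (∧-greatest (≤-trans (x∧y≤y _ _) (x∧y≤x _ _))
                  (≤-trans (∧-greatest (x∧y≤x _ _) (≤-trans (x∧y≤y _ _) (x∧y≤y _ _)))
                           (¬y∧[x⇒¬¬y]≤¬x (¬ a) b)))
      ([x∨¬x]∧¬¬x≤x a)

theorem3p11 : ∀ {c} (A : ResiduatedLattice c) → IsStonean A →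
              let open ResiduatedLattice A in
              ((F : Pred Carrier c) → IsDenseFilter A F → IsAdmissible A (S[_] A F))
              × ((F G : Pred Carrier c) → IsDenseFilter A F → IsDenseFilter A G →
                   S[_] A F ≐ S[_] A G → F ≐ G)
              × ((S : Pred (Carrier × Carrier) c) → IsAdmissible A S →
                   Σ (Pred Carrier c) λ F → IsDenseFilter A F × (S ≐ S[_] A F))
theorem3p11 A stonean =
    (λ F F-dense → FilterSubalgebra.S[]-isAdmissible A stonean (isLatticeFilter F-dense))
  , (λ F G F-dense G-dense (S[F]⊆S[G] , S[G]⊆S[F]) →
        S[]-reflects-⊆ (isLatticeFilter F-dense) G-dense S[F]⊆S[G]
      , S[]-reflects-⊆ (isLatticeFilter G-dense) F-dense S[G]⊆S[F])
  , (λ S S-admissible → let open AdmissibleSubalgebra A S-admissible in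
        filterOf , filterOf-isDenseFilter , S⊆S[filterOf] , S[filterOf]⊆S stonean)
  where
  open IsDenseFilter using (isLatticeFilter)
  open DenseFilterProperties A stonean using (S[]-reflects-⊆)
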